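{- For an integer $t\ge 8$ let $BEF_t=\langle 2t+1,3t-1,3t\rangle\mid_{10t}$. Then for every $t\ge8$ the semigroup $BEF_t$ has conductor $10t$, multiplicity $2t+1$, rank $23$ and genus $10t-23$; moreover $E(BEF_8)=4$, while for every $t\ge9$ the Eliahou constant of $BEF_t$ equals $-1$ (so $BEF_t$ is an Eliahou semigroup), and $BEF_t$ satisfies the Wilf inequality $c\le kp$.
   Context: For a numerical semigroup $\Lambda$ (a cofinite submonoid of $\mathbb N$): the genus is the number of gaps (elements of $\mathbb N\setminus\Lambda$), the conductor $c$ is the largest gap plus one, the multiplicity $m$ is the smallest nonzero element, and the rank $k=c-\text{genus}$ is the number of elements of $\Lambda$ below $c$. Let $p$ be the number of primitive elements (nonzero elements not a sum of two nonzero elements of $\Lambda$), $r$ the number of primitive elements larger than the largest gap, $q=\lceil c/m\rceil$, $\rho=qm-c$. The Eliahou constant is $E(\Lambda)=k(p-r)-q(m-r)+\rho$, and $\Lambda$ is an Eliahou semigroup if $E(\Lambda)<0$. For positive integers $a,b,d,\kappa$, $\langle a,b,d\rangle\mid_\kappa$ is the smallest numerical semigroup containing $a,b,d$ and all integers $\ge\kappa$. -}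

module Defs where

open import Data.Bool using (Bool; true; false; not; _∧_; _∨_; if_then_else_)
open import Data.Nat using (ℕ; zero; suc; _+_; _*_; _∸_; _≤ᵇ_; _<ᵇ_; _≡ᵇ_; _⊔_)
open import Data.List using (List; []; _∷_; upTo; filter; length; foldr; map)
open import Data.Bool.ListAction using (any)
open import Data.Integer using (ℤ; +_; _-_) renaming (_*_ to _*ℤ_; _+_ to _+ℤ_)
open import Relation.Nullary.Decidable using (does)
open import Relation.Unary using (Pred)
open import Data.Bool.Properties using (T?)

-- A numerical semigroup is presented by a Boolean membership test
-- `mem` together with a bound κ such that every n ≥ κ is a member.

count : (ℕ → Bool) → List ℕ → ℕ
count P xs = length (filter (λ n → T? (P n)) xs)

oneTo : ℕ → List ℕ
oneTo n = map suc (upTo n)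

module Invariants (mem : ℕ → Bool) (κ : ℕ) where

  isGap : ℕ → Bool
  isGap n = not (mem n)

  gaps : List ℕ
  gaps = filter (λ n → T? (isGap n)) (upTo κ)

  genus : ℕ
  genus = length gaps

  conductor : ℕ
  conductor = foldr (λ g acc → suc g ⊔ acc) 0 gaps

  firstMem : List ℕ → ℕ
  firstMem []       = κ
  firstMem (n ∷ ns) = if mem n then n else firstMem ns

  multiplicity : ℕ
  multiplicity = firstMem (oneTo (suc κ))

  rank : ℕ
  rank = count mem (upTo conductor)

  isSumOfTwo : ℕ → Bool
  isSumOfTwo n = any (λ a → (a <ᵇ n) ∧ mem a ∧ mem (n ∸ a)) (oneTo n)

  isPrimitive : ℕ → Bool
  isPrimitive n = not (n ≡ᵇ 0) ∧ mem n ∧ not (isSumOfTwo n)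

  -- every primitive element is < c + m ≤ 2κ + 1, so this range suffices
  primRange : List ℕ
  primRange = upTo (suc (κ + κ))

  numPrimitive : ℕ
  numPrimitive = count isPrimitive primRange

  numPrimitiveAbove : ℕ
  numPrimitiveAbove = count (λ n → isPrimitive n ∧ (conductor ≤ᵇ n)) primRange

  ceilDiv : ℕ → ℕ → ℕ
  ceilDiv c m = firstQ (upTo (suc c))
    where
    firstQ : List ℕ → ℕ
    firstQ []       = c
    firstQ (q ∷ qs) = if c ≤ᵇ q * m then q else firstQ qs

  q : ℕ
  q = ceilDiv conductor multiplicity

  ρ : ℕ
  ρ = q * multiplicity ∸ conductor

  eliahou : ℤ
  eliahou = ((+ rank) *ℤ ((+ numPrimitive) - (+ numPrimitiveAbove)))
            - ((+ q) *ℤ ((+ multiplicity) - (+ numPrimitiveAbove)))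
            +ℤ (+ ρ)

-- ⟨a,b,d⟩|κ : smallest numerical semigroup containing a, b, d and all
-- integers ≥ κ.  n belongs iff n ≥ κ or n = x a + y b + z d with x,y,z ∈ ℕ
-- (x, y, z ≤ n suffices when a, b, d ≥ 1).
memGen : ℕ → ℕ → ℕ → ℕ → ℕ → Bool
memGen a b d κ n =
  (κ ≤ᵇ n) ∨
  any (λ x → any (λ y → any (λ z → (x * a + y * b + z * d) ≡ᵇ n)
                                  (upTo (suc n)))
                       (upTo (suc n)))
      (upTo (suc n))

BEFmem : ℕ → ℕ → Bool
BEFmem t = memGen (2 * t + 1) (3 * t ∸ 1) (3 * t) (10 * t)

module BEF (t : ℕ) = Invariants (BEFmem t) (10 * t)

-- Write t = 8 + u. Below the conductor 10t the semigroup consists of exactly 23 combinations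
-- x a + y b + z d of the generators a = 2t+1, b = 3t−1, d = 3t, all of them affine in u and in an
-- order independent of u; so c = 10t, m = a and k = 23. The primitive elements are a, b, d and,
-- for t ≥ 9, the elements of [c, c + m) other than 15 explicit sums of generators, so that
-- p = 3 + r, r = m − 15, q = ρ = 5 and E = 23·3 − 5·15 + 5 = −1; every comparison between
-- these affine forms is decided coefficientwise by evaluation. For t = 8 the invariants are
-- computed outright.

module Submission where

open import Defs
open import Data.Bool using (Bool; true; false; not; _∧_; _∨_; if_then_else_; T)
open import Data.Bool.ListAction using (or; all)
open import Data.Bool.Properties using (T?; T-∧; T-∨; ∧-zeroʳ; ∧-identityʳ)
open import Data.Empty using (⊥-elim)
open import Data.Integer using (+_; -[1+_]; _⊖_) renaming (_-_ to _-ℤ_; _+_ to _+ℤ_; _*_ to _*ℤ_)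
open import Data.Integer.Properties using ([+m]-[+n]≡m⊖n; ⊖-≥)
open import Data.List using (List; []; _∷_; upTo; applyUpTo; length; map; foldr; cartesianProduct)
open import Data.List.Membership.Propositional using (_∈_; _∉_; find; lose)
open import Data.List.Membership.Propositional.Properties
  using (∈-cartesianProduct⁺; ∈-map⁺; ∈-map⁻; ∈-upTo⁺; ∈-filter⁺; ∈-filter⁻)
open import Data.List.Properties using (map-upTo; map-cong; filter-≐)
open import Data.List.Relation.Unary.All using (lookup)
open import Data.List.Relation.Unary.All.Properties using (all⁺)
open import Data.List.Relation.Unary.Any using (here; there)
open import Data.List.Relation.Unary.Any.Properties using (any⁺; any⁻)
open import Data.Nat
open import Data.Nat.Properties
open import Data.Nat.Tactic.RingSolver using (solve-∀)
open import Data.Product using (_×_; _,_; proj₁; proj₂; ∃-syntax)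
open import Data.Product.Properties using (≡-dec)
open import Data.Sum using (_⊎_; inj₁; inj₂; [_,_]′)
open import Data.Unit using (tt)
open import Function using (_∘_; id)
open import Function.Bundles using (module Equivalence)
open import Relation.Binary.PropositionalEquality
open import Relation.Nullary using (¬_; Dec; does; yes; no)
open import Relation.Nullary.Decidable using (dec-true; dec-false)

open Equivalence using (to; from)
open import Algebra.Properties.CommutativeSemigroup +-commutativeSemigroup
  using () renaming (interchange to +-interchange)
open import Data.List.Membership.DecPropositional _≟_ using (_∈?_)
open import Data.List.Membership.DecPropositional (≡-dec _≟_ _≟_) using () renaming (_∈?_ to _∈ᴬ?_)

T-ext : ∀ {x y} → (T x → T y) → (T y → T x) → x ≡ y
T-ext {false} {false} _ _ = refl
T-ext {false} {true}  _ g = ⊥-elim (g tt)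
T-ext {true}  {false} f _ = ⊥-elim (f tt)
T-ext {true}  {true}  _ _ = refl

¬T⇒T-not : ∀ {x} → ¬ T x → T (not x)
¬T⇒T-not {false} _  = tt
¬T⇒T-not {true}  ¬t = ¬t tt

T-not⇒¬T : ∀ {x} → T (not x) → ¬ T x
T-not⇒¬T {false} _ ()

T-does⁻ : ∀ {A : Set} (a? : Dec A) → T (does a?) → A
T-does⁻ (yes a) _ = a

T-does⁺ : ∀ {A : Set} (a? : Dec A) → A → T (does a?)
T-does⁺ (yes _) _ = tt
T-does⁺ (no ¬a) a = ¬a a

T⇒≡true : ∀ {x} → T x → x ≡ true
T⇒≡true {true} _ = refl

¬T⇒≡false : ∀ {x} → ¬ T x → x ≡ false
¬T⇒≡false {false} _ = refl
¬T⇒≡false {true}  ¬t = ⊥-elim (¬t tt)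

+[m+n]-+n≡+m : ∀ m n → + (m + n) -ℤ + n ≡ + m
+[m+n]-+n≡+m m n = begin
  + (m + n) -ℤ + n   ≡⟨ [+m]-[+n]≡m⊖n (m + n) n ⟩
  (m + n) ⊖ n        ≡⟨ ⊖-≥ (m≤n+m n m) ⟩
  + (m + n ∸ n)      ≡⟨ cong +_ (m+n∸n≡m m n) ⟩
  + m                ∎
  where open ≡-Reasoning

≥-elim : ∀ m {P : ℕ → Set} → (∀ u → P (m + u)) → (t : ℕ) → m ≤ t → P t
≥-elim m P[m+_] t m≤t with u , refl ← m≤n⇒∃[o]m+o≡n m≤t = P[m+_] u

indicator : Bool → ℕ
indicator true  = 1
indicator false = 0

countFrom : (ℕ → Bool) → ℕ → ℕ → ℕ
countFrom P a zero    = 0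
countFrom P a (suc n) = indicator (P a) + countFrom P (suc a) n

count-∷ : ∀ P x xs → count P (x ∷ xs) ≡ indicator (P x) + count P xs
count-∷ P x xs with P x
... | true  = refl
... | false = refl

count-cong : ∀ {P Q} → (∀ n → P n ≡ Q n) → ∀ xs → count P xs ≡ count Q xs
count-cong P≗Q []       = refl
count-cong {P} {Q} P≗Q (x ∷ xs) = begin
  count P (x ∷ xs)                 ≡⟨ count-∷ P x xs ⟩
  indicator (P x) + count P xs     ≡⟨ cong₂ _+_ (cong indicator (P≗Q x)) (count-cong P≗Q xs) ⟩
  indicator (Q x) + count Q xs     ≡⟨ count-∷ Q x xs ⟨
  count Q (x ∷ xs)                 ∎
  where open ≡-Reasoning

count-applyUpTo : ∀ P n (f : ℕ → ℕ) a → (∀ i → f i ≡ a + i) →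
                  count P (applyUpTo f n) ≡ countFrom P a n
count-applyUpTo P zero    f a f≗a+ = refl
count-applyUpTo P (suc n) f a f≗a+ = begin
  count P (f 0 ∷ applyUpTo (f ∘ suc) n)
    ≡⟨ count-∷ P (f 0) _ ⟩
  indicator (P (f 0)) + count P (applyUpTo (f ∘ suc) n)
    ≡⟨ cong₂ (λ b k → indicator (P b) + k)
             (trans (f≗a+ 0) (+-identityʳ a))
             (count-applyUpTo P n (f ∘ suc) (suc a) (λ i → trans (f≗a+ (suc i)) (+-suc a i))) ⟩
  countFrom P a (suc n) ∎
  where open ≡-Reasoning

count-upTo : ∀ P n → count P (upTo n) ≡ countFrom P 0 n
count-upTo P n = count-applyUpTo P n id 0 (λ _ → refl)

countFrom-+ : ∀ P a m n → countFrom P a (m + n) ≡ countFrom P a m + countFrom P (a + m) n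
countFrom-+ P a zero    n = cong (λ b → countFrom P b n) (sym (+-identityʳ a))
countFrom-+ P a (suc m) n = begin
  indicator (P a) + countFrom P (suc a) (m + n)
    ≡⟨ cong (_+_ (indicator (P a))) (countFrom-+ P (suc a) m n) ⟩
  indicator (P a) + (countFrom P (suc a) m + countFrom P (suc a + m) n)
    ≡⟨ sym (+-assoc (indicator (P a)) _ _) ⟩
  countFrom P a (suc m) + countFrom P (suc a + m) n
    ≡⟨ cong (λ b → countFrom P a (suc m) + countFrom P b n) (sym (+-suc a m)) ⟩
  countFrom P a (suc m) + countFrom P (a + suc m) n ∎
  where open ≡-Reasoning

countFrom-split : ∀ P m k n → m + k ≤ n → countFrom P 0 n ≡
                  countFrom P 0 m + countFrom P m k + countFrom P (m + k) (n ∸ (m + k))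
countFrom-split P m k n m+k≤n = begin
  countFrom P 0 n
    ≡⟨ cong (countFrom P 0) (m+[n∸m]≡n m+k≤n) ⟨
  countFrom P 0 (m + k + (n ∸ (m + k)))
    ≡⟨ countFrom-+ P 0 (m + k) (n ∸ (m + k)) ⟩
  countFrom P 0 (m + k) + countFrom P (m + k) (n ∸ (m + k))
    ≡⟨ cong (_+ countFrom P (m + k) (n ∸ (m + k))) (countFrom-+ P 0 m k) ⟩
  countFrom P 0 m + countFrom P m k + countFrom P (m + k) (n ∸ (m + k)) ∎
  where open ≡-Reasoning

countFrom-cong : ∀ P Q a n → (∀ i → a ≤ i → i < a + n → P i ≡ Q i) →
                 countFrom P a n ≡ countFrom Q a n
countFrom-cong P Q a zero    P≗Q = refl
countFrom-cong P Q a (suc n) P≗Q =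
  cong₂ _+_ (cong indicator (P≗Q a ≤-refl (m<m+n a z<s)))
            (countFrom-cong P Q (suc a) n (λ i a<i i<a+1+n →
               P≗Q i (<⇒≤ a<i) (subst (i <_) (sym (+-suc a n)) i<a+1+n)))

countFrom-none : ∀ P a n → (∀ i → a ≤ i → i < a + n → ¬ T (P i)) → countFrom P a n ≡ 0
countFrom-none P a zero    ¬P = refl
countFrom-none P a (suc n) ¬P =
  cong₂ _+_ (cong indicator (¬T⇒≡false (¬P a ≤-refl (m<m+n a z<s))))
            (countFrom-none P (suc a) n (λ i a<i i<a+1+n →
               ¬P i (<⇒≤ a<i) (subst (i <_) (sym (+-suc a n)) i<a+1+n)))

countFrom-not : ∀ P a n → countFrom (not ∘ P) a n + countFrom P a n ≡ n
countFrom-not P a zero    = refl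
countFrom-not P a (suc n) = begin
  (indicator (not (P a)) + X) + (indicator (P a) + Y)
    ≡⟨ +-interchange (indicator (not (P a))) X (indicator (P a)) Y ⟩
  (indicator (not (P a)) + indicator (P a)) + (X + Y)
    ≡⟨ cong₂ _+_ (indicator-not (P a)) (countFrom-not P (suc a) n) ⟩
  suc n ∎
  where
  open ≡-Reasoning
  X = countFrom (not ∘ P) (suc a) n
  Y = countFrom P (suc a) n
  indicator-not : ∀ b → indicator (not b) + indicator b ≡ 1
  indicator-not true  = refl
  indicator-not false = refl

Ascending : ℕ → List ℕ → ℕ → Set
Ascending lo []       hi = lo ≤ hi
Ascending lo (x ∷ xs) hi = lo ≤ x × Ascending (suc x) xs hi

∈-Ascending : ∀ {lo xs hi x} → Ascending lo xs hi → x ∈ xs → lo ≤ x × x < hi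
∈-Ascending {xs = y ∷ ys} (lo≤y , asc) (here refl) = lo≤y , ≤-trans (s≤s ≤-refl) (Ascending-≤ asc)
  where
  Ascending-≤ : ∀ {lo xs hi} → Ascending lo xs hi → lo ≤ hi
  Ascending-≤ {xs = []}    lo≤hi       = lo≤hi
  Ascending-≤ {xs = _ ∷ _} (lo≤y , asc) = ≤-trans lo≤y (<⇒≤ (Ascending-≤ asc))
∈-Ascending {xs = y ∷ ys} (lo≤y , asc) (there x∈ys) with ∈-Ascending asc x∈ys
... | y<x , x<hi = ≤-trans lo≤y (<⇒≤ y<x) , x<hi

_∈ᵇ_ : ℕ → List ℕ → Bool
i ∈ᵇ xs = does (i ∈? xs)

∈ᵇ-∷-≢ : ∀ {i x} xs → i ≢ x → i ∈ᵇ (x ∷ xs) ≡ i ∈ᵇ xs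
∈ᵇ-∷-≢ {i} {x} xs i≢x rewrite dec-false (i ≟ x) i≢x = refl

count-Ascending : ∀ n a xs → Ascending a xs (a + n) → countFrom (_∈ᵇ xs) a n ≡ length xs
count-Ascending zero    a []       _   = refl
count-Ascending zero    a (x ∷ xs) asc with ∈-Ascending asc (here refl)
... | a≤x , x<a+0 = ⊥-elim (<⇒≱ x<a+0 (subst (_≤ x) (sym (+-identityʳ a)) a≤x))
count-Ascending (suc n) a []       _   = countFrom-none (_∈ᵇ []) a (suc n) (λ _ _ _ ())
count-Ascending (suc n) a (x ∷ xs) asc@(a≤x , asc′) with a ≟ x
... | yes refl = cong₂ _+_ (cong indicator (dec-true (a ∈? a ∷ xs) (here refl))) (begin
  countFrom (_∈ᵇ (a ∷ xs)) (suc a) n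
    ≡⟨ countFrom-cong _ _ (suc a) n (λ i a<i _ → ∈ᵇ-∷-≢ xs (>⇒≢ a<i)) ⟩
  countFrom (_∈ᵇ xs) (suc a) n
    ≡⟨ count-Ascending n (suc a) xs (subst (Ascending (suc a) xs) (+-suc a n) asc′) ⟩
  length xs ∎)
  where open ≡-Reasoning
... | no a≢x = cong₂ _+_ (cong indicator (dec-false (a ∈? x ∷ xs) a∉))
  (count-Ascending n (suc a) (x ∷ xs) (a<x , subst (Ascending (suc x) xs) (+-suc a n) asc′))
  where
  a<x : a < x
  a<x = ≤∧≢⇒< a≤x a≢x
  a∉ : a ∉ x ∷ xs
  a∉ a∈ = <-irrefl refl (proj₁ (∈-Ascending (a<x , asc′) a∈))

module InvariantFacts (mem : ℕ → Bool) (κ : ℕ) where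
  open Invariants mem κ

  genus+countFrom : genus + countFrom mem 0 κ ≡ κ
  genus+countFrom = begin
    count isGap (upTo κ) + countFrom mem 0 κ ≡⟨ cong (_+ countFrom mem 0 κ) (count-upTo isGap κ) ⟩
    countFrom isGap 0 κ + countFrom mem 0 κ  ≡⟨ countFrom-not mem 0 κ ⟩
    κ                                        ∎
    where open ≡-Reasoning

  conductor-≡ : ∀ g → g < κ → ¬ T (mem g) → (∀ i → g < i → T (mem i)) → conductor ≡ suc g
  conductor-≡ g g<κ gap above = ≤-antisym
    (sup-≤ gaps (λ x x∈gaps → ≮⇒≥ (λ g<x →
      T-not⇒¬T (proj₂ (∈-filter⁻ (T? ∘ isGap) {xs = upTo κ} x∈gaps)) (above x g<x))))
    (∈-sup gaps (∈-filter⁺ (T? ∘ isGap) (∈-upTo⁺ g<κ) (¬T⇒T-not gap)))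
    where
    sup : List ℕ → ℕ
    sup = foldr (λ x acc → suc x ⊔ acc) 0
    sup-≤ : ∀ xs → (∀ x → x ∈ xs → x ≤ g) → sup xs ≤ suc g
    sup-≤ []       _   = z≤n
    sup-≤ (x ∷ xs) xs≤ = ⊔-lub (s≤s (xs≤ x (here refl))) (sup-≤ xs (λ y y∈ → xs≤ y (there y∈)))
    ∈-sup : ∀ {x} xs → x ∈ xs → suc x ≤ sup xs
    ∈-sup (y ∷ ys) (here refl) = m≤m⊔n _ (sup ys)
    ∈-sup (y ∷ ys) (there x∈)  = ≤-trans (∈-sup ys x∈) (m≤n⊔m (suc y) (sup ys))

  private
    firstMem-applyUpTo : ∀ n (f : ℕ → ℕ) a j → (∀ i → f i ≡ a + i) →
                         (∀ i → i < j → ¬ T (mem (a + i))) → T (mem (a + j)) → j < n →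
                         firstMem (applyUpTo f n) ≡ a + j
    firstMem-applyUpTo (suc n) f a zero f≗a+ _ a∈ _
      rewrite f≗a+ 0 | T⇒≡true a∈ = refl
    firstMem-applyUpTo (suc n) f a (suc j) f≗a+ below a+j∈ (s≤s j<n)
      rewrite f≗a+ 0 | ¬T⇒≡false (below 0 z<s) = begin
      firstMem (applyUpTo (f ∘ suc) n)
        ≡⟨ firstMem-applyUpTo n (f ∘ suc) (suc a) j (λ i → trans (f≗a+ (suc i)) (+-suc a i))
             (λ i i<j → subst (¬_ ∘ T ∘ mem) (+-suc a i) (below (suc i) (s≤s i<j)))
             (subst (T ∘ mem) (+-suc a j) a+j∈) j<n ⟩
      suc a + j ≡⟨ sym (+-suc a j) ⟩
      a + suc j ∎
      where open ≡-Reasoning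

  multiplicity-≡ : ∀ m → 0 < m → m ≤ suc κ → (∀ i → 0 < i → i < m → ¬ T (mem i)) → T (mem m) →
                   multiplicity ≡ m
  multiplicity-≡ (suc j) _ m≤1+κ below m∈ =
    trans (cong firstMem (map-upTo suc (suc κ)))
          (firstMem-applyUpTo (suc κ) suc 1 j (λ _ → refl)
                              (λ i i<j → below (suc i) z<s (s≤s i<j)) m∈ m≤1+κ)

  isSumOfTwo-+ : ∀ {m n} → 0 < m → 0 < n → T (mem m) → T (mem n) → T (isSumOfTwo (m + n))
  isSumOfTwo-+ {suc m} {n} _ 0<n m∈ n∈ =
    any⁺ _ (lose (∈-map⁺ suc (∈-upTo⁺ (<⇒≤ m<sum)))
                 (from T-∧ (<⇒<ᵇ m<sum , from T-∧ (m∈ , subst (T ∘ mem) (sym (m+n∸m≡n (suc m) n)) n∈))))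
    where
    m<sum : suc m < suc m + n
    m<sum = m<m+n (suc m) 0<n

  isSumOfTwo-elim : ∀ {n} → T (isSumOfTwo n) →
                    ∃[ a ] (0 < a × a < n × T (mem a) × T (mem (n ∸ a)))
  isSumOfTwo-elim {n} sum with find (any⁻ _ (oneTo n) sum)
  ... | a , a∈oneTo , summand with ∈-map⁻ suc a∈oneTo | to (T-∧ {a <ᵇ n}) summand
  ... | _ , _ , refl | a<ᵇn , both with to (T-∧ {mem a}) both
  ... | a∈ , n-a∈ = a , z<s , <ᵇ⇒< a n a<ᵇn , a∈ , n-a∈

  isSumOfTwo-≥ : ∀ {m n} → (∀ i → 0 < i → T (mem i) → m ≤ i) → T (isSumOfTwo n) → m + m ≤ n
  isSumOfTwo-≥ {m} {n} m≤members sum with isSumOfTwo-elim sum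
  ... | a , 0<a , a<n , a∈ , n-a∈ =
    subst (m + m ≤_) (m+[n∸m]≡n (<⇒≤ a<n))
          (+-mono-≤ (m≤members a 0<a a∈) (m≤members (n ∸ a) (m<n⇒0<n∸m a<n) n-a∈))

  eliahou-≡ : ∀ {k p r q′ m ρ′} → rank ≡ k → numPrimitive ≡ p → numPrimitiveAbove ≡ r →
              q ≡ q′ → multiplicity ≡ m → ρ ≡ ρ′ →
              eliahou ≡ + k *ℤ (+ p -ℤ + r) -ℤ + q′ *ℤ (+ m -ℤ + r) +ℤ + ρ′
  eliahou-≡ refl refl refl refl refl refl = refl

  isPrimitive-elim : ∀ {n} → T (isPrimitive n) → 0 < n × T (mem n) × ¬ T (isSumOfTwo n)
  isPrimitive-elim {zero}  ()
  isPrimitive-elim {suc n} prim with to (T-∧ {mem (suc n)}) prim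
  ... | n∈ , ¬sum = z<s , n∈ , T-not⇒¬T ¬sum

  isPrimitive-member : ∀ {n} → 0 < n → T (mem n) → isPrimitive n ≡ not (isSumOfTwo n)
  isPrimitive-member {suc n} _ n∈ rewrite T⇒≡true n∈ = refl

  isPrimitive-sum : ∀ {n} → T (isSumOfTwo n) → isPrimitive n ≡ false
  isPrimitive-sum {n} sum rewrite T⇒≡true sum =
    trans (cong (not (n ≡ᵇ 0) ∧_) (∧-zeroʳ (mem n))) (∧-zeroʳ _)

module InvariantsCong {f g : ℕ → Bool} (f≗g : ∀ n → f n ≡ g n) (κ : ℕ) where
  private
    module F = Invariants f κ
    module G = Invariants g κ

  gaps-cong : F.gaps ≡ G.gaps
  gaps-cong = filter-≐ (T? ∘ F.isGap) (T? ∘ G.isGap) (same , same′) (upTo κ)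
    where
    same : ∀ {n} → T (F.isGap n) → T (G.isGap n)
    same {n} = subst (T ∘ not) (f≗g n)
    same′ : ∀ {n} → T (G.isGap n) → T (F.isGap n)
    same′ {n} = subst (T ∘ not) (sym (f≗g n))

  conductor-cong : F.conductor ≡ G.conductor
  conductor-cong = cong (foldr (λ x acc → suc x ⊔ acc) 0) gaps-cong

  genus-cong : F.genus ≡ G.genus
  genus-cong = cong length gaps-cong

  multiplicity-cong : F.multiplicity ≡ G.multiplicity
  multiplicity-cong = firstMem-cong (oneTo (suc κ))
    where
    firstMem-cong : ∀ xs → F.firstMem xs ≡ G.firstMem xs
    firstMem-cong []       = refl
    firstMem-cong (x ∷ xs) rewrite f≗g x | firstMem-cong xs = refl

  rank-cong : F.rank ≡ G.rank
  rank-cong = trans (count-cong f≗g (upTo F.conductor)) (cong (count g ∘ upTo) conductor-cong)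

  isPrimitive-cong : ∀ n → F.isPrimitive n ≡ G.isPrimitive n
  isPrimitive-cong n = cong₂ (λ b s → not (n ≡ᵇ 0) ∧ b ∧ not s) (f≗g n) isSumOfTwo-cong
    where
    isSumOfTwo-cong : F.isSumOfTwo n ≡ G.isSumOfTwo n
    isSumOfTwo-cong =
      cong or (map-cong (λ a → cong₂ (λ x y → (a <ᵇ n) ∧ x ∧ y) (f≗g a) (f≗g (n ∸ a))) (oneTo n))

  numPrimitive-cong : F.numPrimitive ≡ G.numPrimitive
  numPrimitive-cong = count-cong isPrimitive-cong F.primRange

  numPrimitiveAbove-cong : F.numPrimitiveAbove ≡ G.numPrimitiveAbove
  numPrimitiveAbove-cong =
    count-cong (λ n → cong₂ (λ p c → p ∧ (c ≤ᵇ n)) (isPrimitive-cong n) conductor-cong) F.primRange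

  eliahou-cong : F.eliahou ≡ G.eliahou
  eliahou-cong rewrite rank-cong | numPrimitive-cong | numPrimitiveAbove-cong
                     | conductor-cong | multiplicity-cong = refl

-- Affine forms in u, compared coefficientwise

Affine : Set
Affine = ℕ × ℕ

⟦_⟧ : Affine → ℕ → ℕ
⟦ A , B ⟧ u = A * u + B

values : ℕ → List Affine → List ℕ
values u = map (λ f → ⟦ f ⟧ u)

_≤ᴬ_ : Affine → Affine → Bool
(A , B) ≤ᴬ (A′ , B′) = (A ≤ᵇ A′) ∧ (B ≤ᵇ B′)

sucᴬ : Affine → Affine
sucᴬ (A , B) = A , suc B

_<ᴬ_ : Affine → Affine → Bool
f <ᴬ g = sucᴬ f ≤ᴬ g

infix  4 _≤ᴬ_ _<ᴬ_
infixl 6 _+ᴬ_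
infixl 7 _·ᴬ_

_+ᴬ_ : Affine → Affine → Affine
(A , B) +ᴬ (A′ , B′) = A + A′ , B + B′

_·ᴬ_ : ℕ → Affine → Affine
k ·ᴬ (A , B) = k * A , k * B

shiftᴬ : Affine → Affine
shiftᴬ (A , B) = A , A + B

≤ᴬ-sound : ∀ u f g → T (f ≤ᴬ g) → ⟦ f ⟧ u ≤ ⟦ g ⟧ u
≤ᴬ-sound u (A , B) (A′ , B′) f≤g with to (T-∧ {A ≤ᵇ A′}) f≤g
... | A≤A′ , B≤B′ = +-mono-≤ (*-monoˡ-≤ u (≤ᵇ⇒≤ A A′ A≤A′)) (≤ᵇ⇒≤ B B′ B≤B′)

<ᴬ-sound : ∀ u f g → T (f <ᴬ g) → ⟦ f ⟧ u < ⟦ g ⟧ u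
<ᴬ-sound u (A , B) g f<g = subst (_≤ ⟦ g ⟧ u) (+-suc (A * u) B) (≤ᴬ-sound u (A , suc B) g f<g)

⟦⟧-+ᴬ : ∀ u f g → ⟦ f +ᴬ g ⟧ u ≡ ⟦ f ⟧ u + ⟦ g ⟧ u
⟦⟧-+ᴬ u (A , B) (A′ , B′) = identity A B A′ B′ u
  where
  identity : ∀ A B A′ B′ u → (A + A′) * u + (B + B′) ≡ A * u + B + (A′ * u + B′)
  identity = solve-∀

⟦⟧-·ᴬ : ∀ u k f → ⟦ k ·ᴬ f ⟧ u ≡ k * ⟦ f ⟧ u
⟦⟧-·ᴬ u k (A , B) = identity k A B u
  where
  identity : ∀ k A B u → k * A * u + k * B ≡ k * (A * u + B)
  identity = solve-∀

⟦⟧-shiftᴬ : ∀ u f → ⟦ f ⟧ (suc u) ≡ ⟦ shiftᴬ f ⟧ u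
⟦⟧-shiftᴬ u (A , B) = identity A B u
  where
  identity : ∀ A B u → A * suc u + B ≡ A * u + (A + B)
  identity = solve-∀

values-suc : ∀ w fs → values (suc w) fs ≡ values w (map shiftᴬ fs)
values-suc w []       = refl
values-suc w (f ∷ fs) = cong₂ _∷_ (⟦⟧-shiftᴬ w f) (values-suc w fs)

ascendingᴬ : Affine → List Affine → Affine → Bool
ascendingᴬ lo []       hi = lo ≤ᴬ hi
ascendingᴬ lo (f ∷ fs) hi = (lo ≤ᴬ f) ∧ ascendingᴬ (sucᴬ f) fs hi

ascendingᴬ-sound : ∀ u lo fs hi → T (ascendingᴬ lo fs hi) →
                   Ascending (⟦ lo ⟧ u) (values u fs) (⟦ hi ⟧ u)
ascendingᴬ-sound u lo []       hi lo≤hi = ≤ᴬ-sound u lo hi lo≤hi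
ascendingᴬ-sound u lo (f ∷ fs) hi asc with to (T-∧ {lo ≤ᴬ f}) asc
... | lo≤f , asc′ = ≤ᴬ-sound u lo f lo≤f ,
  subst (λ l → Ascending l (values u fs) (⟦ hi ⟧ u)) (+-suc (proj₁ f * u) (proj₂ f))
        (ascendingᴬ-sound u (sucᴬ f) fs hi asc′)

memGen-elim : ∀ {a b d κ n} → T (memGen a b d κ n) →
              κ ≤ n ⊎ ∃[ x ] ∃[ y ] ∃[ z ] x * a + y * b + z * d ≡ n
memGen-elim {a} {b} {d} {κ} {n} n∈ with to (T-∨ {κ ≤ᵇ n}) n∈
... | inj₁ κ≤n = inj₁ (≤ᵇ⇒≤ κ n κ≤n)
... | inj₂ n∈⟨a,b,d⟩
  with x , _ , ∈x ← find (any⁻ _ (upTo (suc n)) n∈⟨a,b,d⟩)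
  with y , _ , ∈y ← find (any⁻ _ (upTo (suc n)) ∈x)
  with z , _ , ≡n ← find (any⁻ _ (upTo (suc n)) ∈y)
  = inj₂ (x , y , z , ≡ᵇ⇒≡ _ n ≡n)

memGen-≥ : ∀ {a b d κ n} → κ ≤ n → T (memGen a b d κ n)
memGen-≥ {κ = κ} {n} κ≤n = from (T-∨ {κ ≤ᵇ n}) (inj₁ (≤⇒≤ᵇ κ≤n))

memGen-combination : ∀ {a b d κ} .{{_ : NonZero a}} .{{_ : NonZero b}} .{{_ : NonZero d}} x y z →
                     T (memGen a b d κ (x * a + y * b + z * d))
memGen-combination {a} {b} {d} {κ} x y z = from (T-∨ {κ ≤ᵇ n}) (inj₂
  (any⁺ _ (lose (∈-upTo⁺ (s≤s x≤sum))
  (any⁺ _ (lose (∈-upTo⁺ (s≤s y≤sum))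
  (any⁺ _ (lose (∈-upTo⁺ (s≤s z≤sum)) (≡⇒≡ᵇ n n refl))))))))
  where
  n = x * a + y * b + z * d
  x≤sum : x ≤ n
  x≤sum = m≤n⇒m≤n+o (z * d) (m≤n⇒m≤n+o (y * b) (m≤m*n x a))
  y≤sum : y ≤ n
  y≤sum = m≤n⇒m≤n+o (z * d) (m≤n⇒m≤o+n (x * a) (m≤m*n y b))
  z≤sum : z ≤ n
  z≤sum = m≤n⇒m≤o+n (x * a + y * b) (m≤m*n z d)

-- The elements of BEF_{8+u} below 10(8+u)

combination : ℕ → ℕ → ℕ → ℕ → ℕ
combination t x y z = x * (2 * t + 1) + y * (3 * t ∸ 1) + z * (3 * t)

combination-mono : ∀ t {x x′ y y′ z z′} → x ≤ x′ → y ≤ y′ → z ≤ z′ →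
                   combination t x y z ≤ combination t x′ y′ z′
combination-mono t x≤ y≤ z≤ =
  +-mono-≤ (+-mono-≤ (*-monoˡ-≤ _ x≤) (*-monoˡ-≤ _ y≤)) (*-monoˡ-≤ _ z≤)

combination-+ : ∀ t x y z x′ y′ z′ → combination t (x + x′) (y + y′) (z + z′) ≡
                                     combination t x y z + combination t x′ y′ z′
combination-+ t = identity (2 * t + 1) (3 * t ∸ 1) (3 * t)
  where
  identity : ∀ a b d x y z x′ y′ z′ → (x + x′) * a + (y + y′) * b + (z + z′) * d
                                      ≡ (x * a + y * b + z * d) + (x′ * a + y′ * b + z′ * d)
  identity = solve-∀

x+y+z≤combination : ∀ u x y z → x + y + z ≤ combination (8 + u) x y z
x+y+z≤combination u x y z = +-mono-≤ (+-mono-≤ (m≤m*n x _) (m≤m*n y _)) (m≤m*n z _)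

BEFmem-elim : ∀ t {n} → T (BEFmem t n) → 10 * t ≤ n ⊎ ∃[ x ] ∃[ y ] ∃[ z ] combination t x y z ≡ n
BEFmem-elim t = memGen-elim {2 * t + 1} {3 * t ∸ 1} {3 * t} {10 * t}

BEFmem-combination : ∀ u x y z → T (BEFmem (8 + u) (combination (8 + u) x y z))
BEFmem-combination u =
  memGen-combination {2 * (8 + u) + 1} {3 * (8 + u) ∸ 1} {3 * (8 + u)} {10 * (8 + u)}

aᴬ bᴬ dᴬ κᴬ : Affine
aᴬ = 2 , 17
bᴬ = 3 , 23
dᴬ = 3 , 24
κᴬ = 10 , 80

a-form : ∀ u → ⟦ aᴬ ⟧ u ≡ 2 * (8 + u) + 1
a-form = identity
  where
  identity : ∀ u → 2 * u + 17 ≡ 2 * (8 + u) + 1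
  identity = solve-∀

b-form : ∀ u → ⟦ bᴬ ⟧ u ≡ 3 * (8 + u) ∸ 1
b-form u = cong (_∸ 1) (identity u)
  where
  identity : ∀ u → suc (3 * u + 23) ≡ 3 * (8 + u)
  identity = solve-∀

d-form : ∀ u → ⟦ dᴬ ⟧ u ≡ 3 * (8 + u)
d-form = identity
  where
  identity : ∀ u → 3 * u + 24 ≡ 3 * (8 + u)
  identity = solve-∀

combinationᴬ : ℕ × ℕ × ℕ → Affine
combinationᴬ (x , y , z) = x ·ᴬ aᴬ +ᴬ y ·ᴬ bᴬ +ᴬ z ·ᴬ dᴬ

⟦combinationᴬ⟧ : ∀ u x y z → ⟦ combinationᴬ (x , y , z) ⟧ u ≡ combination (8 + u) x y z
⟦combinationᴬ⟧ u x y z = begin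
  ⟦ x ·ᴬ aᴬ +ᴬ y ·ᴬ bᴬ +ᴬ z ·ᴬ dᴬ ⟧ u
    ≡⟨ trans (⟦⟧-+ᴬ u (x ·ᴬ aᴬ +ᴬ y ·ᴬ bᴬ) (z ·ᴬ dᴬ))
             (cong (_+ ⟦ z ·ᴬ dᴬ ⟧ u) (⟦⟧-+ᴬ u (x ·ᴬ aᴬ) (y ·ᴬ bᴬ))) ⟩
  ⟦ x ·ᴬ aᴬ ⟧ u + ⟦ y ·ᴬ bᴬ ⟧ u + ⟦ z ·ᴬ dᴬ ⟧ u
    ≡⟨ cong₂ _+_ (cong₂ _+_ (⟦⟧-·ᴬ u x aᴬ) (⟦⟧-·ᴬ u y bᴬ)) (⟦⟧-·ᴬ u z dᴬ) ⟩
  x * ⟦ aᴬ ⟧ u + y * ⟦ bᴬ ⟧ u + z * ⟦ dᴬ ⟧ u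
    ≡⟨ cong₂ _+_ (cong₂ _+_ (cong (x *_) (a-form u)) (cong (y *_) (b-form u)))
                 (cong (z *_) (d-form u)) ⟩
  combination (8 + u) x y z ∎
  where
  open ≡-Reasoning

κ-form : ∀ u → 10 * (8 + u) ≡ ⟦ κᴬ ⟧ u
κ-form = identity
  where
  identity : ∀ u → 10 * (8 + u) ≡ 10 * u + 80
  identity = solve-∀

positiveTriples : List (ℕ × ℕ × ℕ)
positiveTriples =
  (1 , 0 , 0) ∷ (0 , 1 , 0) ∷ (0 , 0 , 1) ∷ (2 , 0 , 0) ∷ (1 , 1 , 0) ∷
  (1 , 0 , 1) ∷ (0 , 2 , 0) ∷ (0 , 1 , 1) ∷ (0 , 0 , 2) ∷ (3 , 0 , 0) ∷ (2 , 1 , 0) ∷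
  (2 , 0 , 1) ∷ (1 , 2 , 0) ∷ (1 , 1 , 1) ∷ (1 , 0 , 2) ∷ (4 , 0 , 0) ∷ (0 , 3 , 0) ∷
  (0 , 2 , 1) ∷ (0 , 1 , 2) ∷ (0 , 0 , 3) ∷ (3 , 1 , 0) ∷ (3 , 0 , 1) ∷ []

smallTriples : List (ℕ × ℕ × ℕ)
smallTriples = (0 , 0 , 0) ∷ positiveTriples

smallForms : List Affine
smallForms = map combinationᴬ smallTriples

-- 5a, 4b and 4d already reach κ, so only this box of coefficients matters
box : List (ℕ × ℕ × ℕ)
box = cartesianProduct (upTo 5) (cartesianProduct (upTo 4) (upTo 4))

smallOrLarge : ℕ × ℕ × ℕ → Bool
smallOrLarge w = does (combinationᴬ w ∈ᴬ? smallForms) ∨ (κᴬ ≤ᴬ combinationᴬ w)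

box-small-or-large : T (all smallOrLarge box)
box-small-or-large = tt

κ≤combination : ∀ u x y z {x′ y′ z′} → T (κᴬ ≤ᴬ combinationᴬ (x , y , z)) →
                x ≤ x′ → y ≤ y′ → z ≤ z′ → 10 * (8 + u) ≤ combination (8 + u) x′ y′ z′
κ≤combination u x y z {x′} {y′} {z′} κ≤ x≤ y≤ z≤ = begin
  10 * (8 + u)                  ≡⟨ κ-form u ⟩
  ⟦ κᴬ ⟧ u                      ≤⟨ ≤ᴬ-sound u κᴬ (combinationᴬ (x , y , z)) κ≤ ⟩
  ⟦ combinationᴬ (x , y , z) ⟧ u ≡⟨ ⟦combinationᴬ⟧ u x y z ⟩
  combination (8 + u) x y z     ≤⟨ combination-mono (8 + u) x≤ y≤ z≤ ⟩
  combination (8 + u) x′ y′ z′  ∎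
  where open ≤-Reasoning

combination-below-κ : ∀ u x y z → combination (8 + u) x y z < 10 * (8 + u) →
                      combinationᴬ (x , y , z) ∈ smallForms
combination-below-κ u x y z below with x <? 5 | y <? 4 | z <? 4
... | no x≮5 | _ | _ = ⊥-elim (<⇒≱ below (κ≤combination u 5 0 0 {x} {y} {z} tt (≮⇒≥ x≮5) z≤n z≤n))
... | _ | no y≮4 | _ = ⊥-elim (<⇒≱ below (κ≤combination u 0 4 0 {x} {y} {z} tt z≤n (≮⇒≥ y≮4) z≤n))
... | _ | _ | no z≮4 = ⊥-elim (<⇒≱ below (κ≤combination u 0 0 4 {x} {y} {z} tt z≤n z≤n (≮⇒≥ z≮4)))
... | yes x<5 | yes y<4 | yes z<4 =
  [ T-does⁻ (combinationᴬ (x , y , z) ∈ᴬ? smallForms)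
  , (λ large → ⊥-elim (<⇒≱ below (κ≤combination u x y z large ≤-refl ≤-refl ≤-refl)))
  ]′ (to (T-∨ {does (combinationᴬ (x , y , z) ∈ᴬ? smallForms)})
         (lookup (all⁺ smallOrLarge box box-small-or-large)
           (∈-cartesianProduct⁺ (∈-upTo⁺ x<5) (∈-cartesianProduct⁺ (∈-upTo⁺ y<4) (∈-upTo⁺ z<4)))))

BEFmemExplicit : ℕ → ℕ → Bool
BEFmemExplicit u n = (10 * (8 + u) ≤ᵇ n) ∨ (n ∈ᵇ values u smallForms)

BEFmem≡explicit : ∀ u n → BEFmem (8 + u) n ≡ BEFmemExplicit u n
BEFmem≡explicit u n = T-ext forward backward
  where
  large : 10 * (8 + u) ≤ n → T (BEFmemExplicit u n)
  large κ≤n = from (T-∨ {10 * (8 + u) ≤ᵇ n} {n ∈ᵇ values u smallForms}) (inj₁ (≤⇒≤ᵇ κ≤n))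
  forward : T (BEFmem (8 + u) n) → T (BEFmemExplicit u n)
  forward n∈ with BEFmem-elim (8 + u) n∈
  ... | inj₁ κ≤n = large κ≤n
  ... | inj₂ (x , y , z , ≡n) with n <? 10 * (8 + u)
  ...   | no n≮κ = large (≮⇒≥ n≮κ)
  ...   | yes n<κ = from (T-∨ {10 * (8 + u) ≤ᵇ n} {n ∈ᵇ values u smallForms})
    (inj₂ (T-does⁺ (n ∈? values u smallForms)
      (subst (_∈ values u smallForms) (trans (⟦combinationᴬ⟧ u x y z) ≡n)
        (∈-map⁺ (λ f → ⟦ f ⟧ u) (combination-below-κ u x y z (subst (_< 10 * (8 + u)) (sym ≡n) n<κ))))))
  backward : T (BEFmemExplicit u n) → T (BEFmem (8 + u) n)
  backward n∈ with to (T-∨ {10 * (8 + u) ≤ᵇ n}) n∈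
  ... | inj₁ κ≤n = memGen-≥ (≤ᵇ⇒≤ _ n κ≤n)
  ... | inj₂ listed
    with ∈-map⁻ (λ f → ⟦ f ⟧ u) {xs = smallForms} (T-does⁻ (n ∈? values u smallForms) listed)
  ... | f , f∈ , n≡ with ∈-map⁻ combinationᴬ {xs = smallTriples} f∈
  ... | (x , y , z) , _ , refl =
    subst (T ∘ BEFmem (8 + u)) (sym (trans n≡ (⟦combinationᴬ⟧ u x y z))) (BEFmem-combination u x y z)

module ExplicitBEF (u : ℕ) where
  κ : ℕ
  κ = 10 * (8 + u)

  -- The bound is 10 * (8 + u) rather than κ so that these are syntactically the invariants of BEFCong.
  open Invariants (BEFmemExplicit u) (10 * (8 + u)) public
  open InvariantFacts (BEFmemExplicit u) (10 * (8 + u)) public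
  private
    mem = BEFmemExplicit u

  small positive : List ℕ
  small    = values u smallForms
  positive = values u (map combinationᴬ positiveTriples)

  a γ : ℕ
  a = ⟦ aᴬ ⟧ u
  γ = ⟦ 10 , 79 ⟧ u

  κ≡1+γ : κ ≡ suc γ
  κ≡1+γ = trans (κ-form u) (+-suc (10 * u) 79)

  positive-ascending : Ascending a positive γ
  positive-ascending = ascendingᴬ-sound u aᴬ (map combinationᴬ positiveTriples) (10 , 79) tt

  mem-below-κ : ∀ {i} → i < κ → mem i ≡ i ∈ᵇ small
  mem-below-κ {i} i<κ = cong (_∨ (i ∈ᵇ small)) (¬T⇒≡false (<⇒≱ i<κ ∘ ≤ᵇ⇒≤ κ i))

  mem-above-γ : ∀ {i} → γ < i → T (mem i)
  mem-above-γ {i} γ<i = from (T-∨ {κ ≤ᵇ i} {i ∈ᵇ small}) (inj₁ (≤⇒≤ᵇ (subst (_≤ i) (sym κ≡1+γ) γ<i)))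

  positive-member : ∀ {i} → 0 < i → i < κ → T (mem i) → i ∈ positive
  positive-member {i} 0<i i<κ i∈ with T-does⁻ (i ∈? small) (subst T (mem-below-κ i<κ) i∈)
  ... | here refl = ⊥-elim (<-irrefl refl 0<i)
  ... | there i∈positive = i∈positive

  a≤member : ∀ i → 0 < i → T (mem i) → a ≤ i
  a≤member i 0<i i∈ with i <? κ
  ... | yes i<κ = proj₁ (∈-Ascending positive-ascending (positive-member 0<i i<κ i∈))
  ... | no i≮κ = ≤-trans (<⇒≤ (≤-trans a<γ (n≤1+n γ))) (subst (_≤ i) κ≡1+γ (≮⇒≥ i≮κ))
    where
    a<γ : a < γ
    a<γ = <ᴬ-sound u aᴬ (10 , 79) tt

  conductor≡κ : conductor ≡ κ
  conductor≡κ =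
    trans (conductor-≡ γ (subst (γ <_) (sym κ≡1+γ) ≤-refl) γ-gap (λ _ → mem-above-γ)) (sym κ≡1+γ)
    where
    0<γ : 0 < γ
    0<γ = <-≤-trans z<s (m≤n+m 79 (10 * u))
    γ-gap : ¬ T (mem γ)
    γ-gap γ∈ = <-irrefl refl (proj₂ (∈-Ascending positive-ascending
      (positive-member 0<γ (subst (γ <_) (sym κ≡1+γ) ≤-refl) γ∈)))

  small-ascending : Ascending 0 small κ
  small-ascending = subst (Ascending 0 small) (sym (κ-form u)) (ascendingᴬ-sound u (0 , 0) smallForms κᴬ tt)

  countFrom-κ : countFrom mem 0 κ ≡ 23
  countFrom-κ = trans (countFrom-cong mem (_∈ᵇ small) 0 κ (λ _ _ i<κ → mem-below-κ i<κ))
                      (count-Ascending κ 0 small small-ascending)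

  rank≡23 : rank ≡ 23
  rank≡23 = trans (cong (count mem ∘ upTo) conductor≡κ) (trans (count-upTo mem κ) countFrom-κ)

  genus≡κ∸23 : genus ≡ κ ∸ 23
  genus≡κ∸23 = begin
    genus                           ≡⟨ m+n∸n≡m genus 23 ⟨
    genus + 23 ∸ 23                 ≡⟨ cong (λ k → genus + k ∸ 23) countFrom-κ ⟨
    genus + countFrom mem 0 κ ∸ 23  ≡⟨ cong (_∸ 23) genus+countFrom ⟩
    κ ∸ 23                          ∎
    where open ≡-Reasoning

  0<a : 0 < a
  0<a = <-≤-trans z<s (m≤n+m 17 (2 * u))

  a∈ : T (mem a)
  a∈ = from (T-∨ {κ ≤ᵇ a} {a ∈ᵇ small}) (inj₂ (T-does⁺ (a ∈? small) (there (here refl))))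

  a<κ : a < κ
  a<κ = subst (a <_) (sym (κ-form u)) (<ᴬ-sound u aᴬ κᴬ tt)

  multiplicity≡a : multiplicity ≡ a
  multiplicity≡a = multiplicity-≡ a 0<a (≤-trans (<⇒≤ a<κ) (n≤1+n κ))
    (λ i 0<i i<a i∈ → <⇒≱ i<a (a≤member i 0<i i∈)) a∈

  combination∈ : ∀ x y z → T (mem (combination (8 + u) x y z))
  combination∈ x y z =
    subst T (BEFmem≡explicit u (combination (8 + u) x y z)) (BEFmem-combination u x y z)

  isSumOfTwo-combination : ∀ x y z x′ y′ z′ → 0 < x + y + z → 0 < x′ + y′ + z′ →
                           T (isSumOfTwo (combination (8 + u) (x + x′) (y + y′) (z + z′)))
  isSumOfTwo-combination x y z x′ y′ z′ 0<s 0<s′ =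
    subst (T ∘ isSumOfTwo) (sym (combination-+ (8 + u) x y z x′ y′ z′))
      (isSumOfTwo-+ (<-≤-trans 0<s (x+y+z≤combination u x y z))
                    (<-≤-trans 0<s′ (x+y+z≤combination u x′ y′ z′))
                    (combination∈ x y z) (combination∈ x′ y′ z′))

  combination-isSumOfTwo : ∀ x y z → 2 ≤ x + y + z → T (isSumOfTwo (combination (8 + u) x y z))
  combination-isSumOfTwo (suc x) y       z       (s≤s 0<s) = isSumOfTwo-combination 1 0 0 x y z z<s 0<s
  combination-isSumOfTwo zero    (suc y) z       (s≤s 0<s) = isSumOfTwo-combination 0 1 0 0 y z z<s 0<s
  combination-isSumOfTwo zero    zero    (suc z) (s≤s 0<s) = isSumOfTwo-combination 0 0 1 0 0 z z<s 0<s

  generatorForms : List Affine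
  generatorForms = aᴬ ∷ bᴬ ∷ dᴬ ∷ []

  generators : List ℕ
  generators = values u generatorForms

  generator∈small : ∀ {i} → i ∈ generators → i ∈ small
  generator∈small (here i≡a)                = there (here i≡a)
  generator∈small (there (here i≡b))        = there (there (here i≡b))
  generator∈small (there (there (here i≡d))) = there (there (there (here i≡d)))

  generator<a+a : ∀ {i} → i ∈ generators → i < a + a
  generator<a+a {i} i∈ = subst (i <_) (⟦⟧-+ᴬ u aᴬ aᴬ)
    (proj₂ (∈-Ascending (ascendingᴬ-sound u (0 , 0) generatorForms (aᴬ +ᴬ aᴬ) tt) i∈))

  combination-generator : ∀ x y z → x + y + z < 2 → 0 < combination (8 + u) x y z →
                          combination (8 + u) x y z ∈ generators
  combination-generator 0 0 0 _ ()
  combination-generator 1 0 0 _ _ = here (sym (⟦combinationᴬ⟧ u 1 0 0))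
  combination-generator 0 1 0 _ _ = there (here (sym (⟦combinationᴬ⟧ u 0 1 0)))
  combination-generator 0 0 1 _ _ = there (there (here (sym (⟦combinationᴬ⟧ u 0 0 1))))
  combination-generator (suc (suc _)) _ _ (s≤s (s≤s ())) _
  combination-generator 1 (suc _) _ (s≤s (s≤s ())) _
  combination-generator 1 0 (suc _) (s≤s (s≤s ())) _
  combination-generator 0 (suc (suc _)) _ (s≤s (s≤s ())) _
  combination-generator 0 1 (suc _) (s≤s (s≤s ())) _
  combination-generator 0 0 (suc (suc _)) (s≤s (s≤s ())) _

  combination-primitive : ∀ x y z → 0 < combination (8 + u) x y z →
                          ¬ T (isSumOfTwo (combination (8 + u) x y z)) →
                          combination (8 + u) x y z ∈ generators
  combination-primitive x y z 0<c ¬sum with 2 ≤? x + y + z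
  ... | yes two = ⊥-elim (¬sum (combination-isSumOfTwo x y z two))
  ... | no ¬two = combination-generator x y z (≰⇒> ¬two) 0<c

  primitive-below-κ : ∀ {i} → i < κ → isPrimitive i ≡ i ∈ᵇ generators
  primitive-below-κ {i} i<κ = T-ext primitive⇒generator generator⇒primitive
    where
    primitive⇒generator : T (isPrimitive i) → T (i ∈ᵇ generators)
    primitive⇒generator prim with isPrimitive-elim prim
    ... | 0<i , i∈ , ¬sum with ∈-map⁻ (λ f → ⟦ f ⟧ u) (positive-member 0<i i<κ i∈)
    ... | f , f∈ , i≡f with ∈-map⁻ combinationᴬ {xs = positiveTriples} f∈
    ... | (x , y , z) , _ , f≡ = T-does⁺ (i ∈? generators)
            (subst (_∈ generators) (sym i≡) (combination-primitive x y z
              (subst (0 <_) i≡ 0<i) (¬sum ∘ subst (T ∘ isSumOfTwo) (sym i≡))))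
      where
      i≡ : i ≡ combination (8 + u) x y z
      i≡ = trans i≡f (trans (cong (λ f → ⟦ f ⟧ u) f≡) (⟦combinationᴬ⟧ u x y z))
    generator⇒primitive : T (i ∈ᵇ generators) → T (isPrimitive i)
    generator⇒primitive listed = subst T (sym (isPrimitive-member 0<i i∈)) (¬T⇒T-not ¬sum)
      where
      i∈gens = T-does⁻ (i ∈? generators) listed
      0<i : 0 < i
      0<i = <-≤-trans 0<a (proj₁ (∈-Ascending (ascendingᴬ-sound u aᴬ generatorForms κᴬ tt) i∈gens))
      i∈ : T (mem i)
      i∈ = subst T (sym (mem-below-κ i<κ)) (T-does⁺ (i ∈? small) (generator∈small i∈gens))
      ¬sum : ¬ T (isSumOfTwo i)
      ¬sum sum = <⇒≱ (generator<a+a i∈gens) (isSumOfTwo-≥ a≤member sum)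

  primitive-above-κ+a : ∀ {i} → κ + a ≤ i → isPrimitive i ≡ false
  primitive-above-κ+a {i} κ+a≤i = isPrimitive-sum {i} (subst (T ∘ isSumOfTwo) (m+[n∸m]≡n a≤i)
    (isSumOfTwo-+ 0<a (<-≤-trans z<s κ≤i∸a) a∈ (mem-above-γ (subst (_≤ i ∸ a) κ≡1+γ κ≤i∸a))))
    where
    a≤i : a ≤ i
    a≤i = m+n≤o⇒n≤o κ κ+a≤i
    κ≤i∸a : κ ≤ i ∸ a
    κ≤i∸a = m+n≤o⇒m≤o∸n κ κ+a≤i

  q≡5 : q ≡ 5
  q≡5 = begin
    ceilDiv conductor multiplicity ≡⟨ cong₂ ceilDiv conductor≡κ multiplicity≡a ⟩
    ceilDiv κ a                   ≡⟨ if-false (κ≰ 1 tt) ⟩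
    _                             ≡⟨ if-false (κ≰ 2 tt) ⟩
    _                             ≡⟨ if-false (κ≰ 3 tt) ⟩
    _                             ≡⟨ if-false (κ≰ 4 tt) ⟩
    _                             ≡⟨ if-true (≤⇒≤ᵇ κ≤5a) ⟩
    5                             ∎
    where
    open ≡-Reasoning
    if-false : ∀ {b} {x y : ℕ} → b ≡ false → (if b then x else y) ≡ y
    if-false refl = refl
    if-true : ∀ {b} {x y : ℕ} → T b → (if b then x else y) ≡ x
    if-true {true} _ = refl
    κ≰ : ∀ j → T (j ·ᴬ aᴬ <ᴬ κᴬ) → (κ ≤ᵇ j * a) ≡ false
    κ≰ j j·a<κ = ¬T⇒≡false (<⇒≱ j*a<κ ∘ ≤ᵇ⇒≤ κ (j * a))
      where
      j*a<κ : j * a < κ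
      j*a<κ = subst₂ _<_ (⟦⟧-·ᴬ u j aᴬ) (sym (κ-form u)) (<ᴬ-sound u (j ·ᴬ aᴬ) κᴬ j·a<κ)
    κ≤5a : κ ≤ 5 * a
    κ≤5a = subst₂ _≤_ (sym (κ-form u)) (⟦⟧-·ᴬ u 5 aᴬ) (≤ᴬ-sound u κᴬ (5 ·ᴬ aᴬ) tt)

  ρ≡5 : ρ ≡ 5
  ρ≡5 = begin
    q * multiplicity ∸ conductor ≡⟨ cong₂ (λ k c → k * multiplicity ∸ c) q≡5 conductor≡κ ⟩
    5 * multiplicity ∸ κ         ≡⟨ cong (λ m → 5 * m ∸ κ) multiplicity≡a ⟩
    5 * a ∸ κ                    ≡⟨ cong (_∸ κ) (identity u) ⟩
    κ + 5 ∸ κ                    ≡⟨ m+n∸m≡n κ 5 ⟩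
    5                            ∎
    where
    open ≡-Reasoning
    identity : ∀ u → 5 * (2 * u + 17) ≡ 10 * (8 + u) + 5
    identity = solve-∀

  generators-ascending : Ascending 0 generators κ
  generators-ascending =
    subst (Ascending 0 generators) (sym (κ-form u)) (ascendingᴬ-sound u (0 , 0) generatorForms κᴬ tt)

  countFrom-primitive-below-κ : countFrom isPrimitive 0 κ ≡ 3
  countFrom-primitive-below-κ =
    trans (countFrom-cong isPrimitive (_∈ᵇ generators) 0 κ (λ _ _ i<κ → primitive-below-κ i<κ))
          (count-Ascending κ 0 generators generators-ascending)

  countFrom-primitive-above-κ+a : ∀ n → countFrom isPrimitive (κ + a) n ≡ 0
  countFrom-primitive-above-κ+a n = countFrom-none isPrimitive (κ + a) n
    (λ i κ+a≤i _ → subst T (primitive-above-κ+a κ+a≤i))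

  ℓ : ℕ
  ℓ = suc (κ + κ) ∸ (κ + a)

  primRange-split : ∀ P → count P primRange ≡ countFrom P 0 κ + countFrom P κ a + countFrom P (κ + a) ℓ
  primRange-split P = trans (count-upTo P (suc (κ + κ)))
    (countFrom-split P κ a (suc (κ + κ)) (≤-trans (+-monoʳ-≤ κ (<⇒≤ a<κ)) (n≤1+n (κ + κ))))

-- Primitive elements of BEF_{9+w} between c and c + m

module ExplicitBEF⁺ (w : ℕ) where
  open ExplicitBEF (suc w) public
  private
    mem = BEFmemExplicit (suc w)

  sumTriples : List (ℕ × ℕ × ℕ)
  sumTriples =
    (2 , 2 , 0) ∷ (2 , 1 , 1) ∷ (2 , 0 , 2) ∷ (5 , 0 , 0) ∷ (1 , 3 , 0) ∷ (1 , 2 , 1) ∷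
    (1 , 1 , 2) ∷ (1 , 0 , 3) ∷ (4 , 1 , 0) ∷ (4 , 0 , 1) ∷ (0 , 4 , 0) ∷ (0 , 3 , 1) ∷
    (0 , 2 , 2) ∷ (0 , 1 , 3) ∷ (0 , 0 , 4) ∷ []

  sumForms : List Affine
  sumForms = map combinationᴬ sumTriples

  sums : List ℕ
  sums = values (suc w) sumForms

  κ≡ : κ ≡ ⟦ 10 , 90 ⟧ w
  κ≡ = identity w
    where
    identity : ∀ w → 10 * (8 + suc w) ≡ 10 * w + 90
    identity = solve-∀

  κ+a≡ : κ + a ≡ ⟦ 12 , 109 ⟧ w
  κ+a≡ = identity w
    where
    identity : ∀ w → 10 * (8 + suc w) + (2 * suc w + 17) ≡ 12 * w + 109
    identity = solve-∀

  sums-ascending : Ascending κ sums (κ + a)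
  sums-ascending = subst₂ (λ lo hi → Ascending lo sums hi) (sym κ≡) (sym κ+a≡)
    (subst (λ xs → Ascending (⟦ 10 , 90 ⟧ w) xs (⟦ 12 , 109 ⟧ w)) (sym (values-suc w sumForms))
      (ascendingᴬ-sound w (10 , 90) (map shiftᴬ sumForms) (12 , 109) tt))

  size : ℕ × ℕ × ℕ → ℕ
  size (x , y , z) = x + y + z

  sumTriples-large : T (all (λ s → 2 ≤ᵇ size s) sumTriples)
  sumTriples-large = tt

  sum-isSumOfTwo : ∀ {i} → i ∈ sums → T (isSumOfTwo i)
  sum-isSumOfTwo {i} i∈ with ∈-map⁻ (λ f → ⟦ f ⟧ (suc w)) i∈
  ... | f , f∈ , i≡f with ∈-map⁻ combinationᴬ {xs = sumTriples} f∈
  ... | (x , y , z) , s∈ , f≡ =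
    subst (T ∘ isSumOfTwo) (sym (trans i≡f (trans (cong (λ f → ⟦ f ⟧ (suc w)) f≡) (⟦combinationᴬ⟧ (suc w) x y z))))
      (combination-isSumOfTwo x y z
        (≤ᵇ⇒≤ 2 (x + y + z) (lookup (all⁺ (λ s → 2 ≤ᵇ size s) sumTriples sumTriples-large) s∈)))

  -- The coefficientwise comparisons below hold for forms in w = u − 1, but not in u.
  positiveFormsʷ sumFormsʷ : List Affine
  positiveFormsʷ = map shiftᴬ (map combinationᴬ positiveTriples)
  sumFormsʷ      = map shiftᴬ sumForms

  outsideOrSum : Affine → Affine → Bool
  outsideOrSum f g = (f +ᴬ g <ᴬ (10 , 90)) ∨ ((12 , 109) ≤ᴬ f +ᴬ g) ∨ does (f +ᴬ g ∈ᴬ? sumFormsʷ)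

  outsideOrSum-cases : ∀ f g → T (outsideOrSum f g) →
                       T (f +ᴬ g <ᴬ (10 , 90)) ⊎ T ((12 , 109) ≤ᴬ f +ᴬ g) ⊎ f +ᴬ g ∈ sumFormsʷ
  outsideOrSum-cases f g h with to (T-∨ {f +ᴬ g <ᴬ (10 , 90)}) h
  ... | inj₁ below = inj₁ below
  ... | inj₂ h′ with to (T-∨ {(12 , 109) ≤ᴬ f +ᴬ g}) h′
  ...   | inj₁ above  = inj₂ (inj₁ above)
  ...   | inj₂ listed = inj₂ (inj₂ (T-does⁻ (f +ᴬ g ∈ᴬ? sumFormsʷ) listed))

  positive-pairs : T (all (λ f → all (outsideOrSum f) positiveFormsʷ) positiveFormsʷ)
  positive-pairs = tt

  positive-pair : ∀ {f g} → f ∈ positiveFormsʷ → g ∈ positiveFormsʷ → T (outsideOrSum f g)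
  positive-pair {f} f∈ g∈ = lookup (all⁺ (outsideOrSum f) positiveFormsʷ
    (lookup (all⁺ (λ f → all (outsideOrSum f) positiveFormsʷ) positiveFormsʷ positive-pairs) f∈)) g∈

  summand<κ : ∀ {m n} → m + n < κ + a → 0 < n → T (mem n) → m < κ
  summand<κ {m} {n} m+n<κ+a 0<n n∈ with m <? κ
  ... | yes m<κ = m<κ
  ... | no m≮κ = ⊥-elim (<⇒≱ m+n<κ+a (+-mono-≤ (≮⇒≥ m≮κ) (a≤member n 0<n n∈)))

  positive-memberʷ : ∀ {m} → 0 < m → m < κ → T (mem m) → m ∈ values w positiveFormsʷ
  positive-memberʷ {m} 0<m m<κ m∈ =
    subst (m ∈_) (values-suc w (map combinationᴬ positiveTriples)) (positive-member 0<m m<κ m∈)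

  window-sum : ∀ {p q} → 0 < p → 0 < q → T (mem p) → T (mem q) →
               κ ≤ p + q → p + q < κ + a → p + q ∈ sums
  window-sum {p} {q} 0<p 0<q p∈ q∈ κ≤p+q p+q<κ+a =
    from-forms (∈-map⁻ (λ f → ⟦ f ⟧ w) (positive-memberʷ 0<p (summand<κ p+q<κ+a 0<q q∈) p∈))
               (∈-map⁻ (λ f → ⟦ f ⟧ w)
                 (positive-memberʷ 0<q (summand<κ (subst (_< κ + a) (+-comm p q) p+q<κ+a) 0<p p∈) q∈))
    where
    from-forms : ∃[ f ] (f ∈ positiveFormsʷ × p ≡ ⟦ f ⟧ w) →
                 ∃[ g ] (g ∈ positiveFormsʷ × q ≡ ⟦ g ⟧ w) → p + q ∈ sums
    from-forms (f , f∈ , p≡) (g , g∈ , q≡) =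
      [ (λ below → ⊥-elim (<⇒≱ (subst₂ _<_ (sym p+q≡) (sym κ≡) (<ᴬ-sound w (f +ᴬ g) (10 , 90) below))
                                κ≤p+q))
      , [ (λ above → ⊥-elim (<⇒≱ p+q<κ+a
                               (subst₂ _≤_ (sym κ+a≡) (sym p+q≡) (≤ᴬ-sound w (12 , 109) (f +ᴬ g) above))))
        , (λ listed → subst₂ _∈_ (sym p+q≡) (sym (values-suc w sumForms))
                                (∈-map⁺ (λ f → ⟦ f ⟧ w) listed))
        ]′
      ]′ (outsideOrSum-cases f g (positive-pair f∈ g∈))
      where
      p+q≡ : p + q ≡ ⟦ f +ᴬ g ⟧ w
      p+q≡ = trans (cong₂ _+_ p≡ q≡) (sym (⟦⟧-+ᴬ w f g))

  isSumOfTwo-window : ∀ {i} → κ ≤ i → i < κ + a → T (isSumOfTwo i) → i ∈ sums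
  isSumOfTwo-window {i} κ≤i i<κ+a sum with isSumOfTwo-elim sum
  ... | p , 0<p , p<i , p∈ , q∈ = subst (_∈ sums) p+q≡i
    (window-sum 0<p (m<n⇒0<n∸m p<i) p∈ q∈
                (subst (κ ≤_) (sym p+q≡i) κ≤i) (subst (_< κ + a) (sym p+q≡i) i<κ+a))
    where
    p+q≡i : p + (i ∸ p) ≡ i
    p+q≡i = m+[n∸m]≡n (<⇒≤ p<i)

  primitive-window : ∀ {i} → κ ≤ i → i < κ + a → isPrimitive i ≡ not (i ∈ᵇ sums)
  primitive-window {i} κ≤i i<κ+a =
    trans (isPrimitive-member (<-≤-trans z<s κ≤i) (mem-above-γ (subst (_≤ i) κ≡1+γ κ≤i)))
          (cong not (T-ext (T-does⁺ (i ∈? sums) ∘ isSumOfTwo-window κ≤i i<κ+a)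
                           (sum-isSumOfTwo ∘ T-does⁻ (i ∈? sums))))

  r : ℕ
  r = countFrom isPrimitive κ a

  r+15≡a : r + 15 ≡ a
  r+15≡a = begin
    r + 15
      ≡⟨ cong₂ _+_ (countFrom-cong isPrimitive (not ∘ (_∈ᵇ sums)) κ a (λ _ → primitive-window))
                   (sym (count-Ascending a κ sums sums-ascending)) ⟩
    countFrom (not ∘ (_∈ᵇ sums)) κ a + countFrom (_∈ᵇ sums) κ a
      ≡⟨ countFrom-not (_∈ᵇ sums) κ a ⟩
    a ∎
    where open ≡-Reasoning

  r≡2w+4 : r ≡ 2 * w + 4
  r≡2w+4 = +-cancelʳ-≡ 15 r (2 * w + 4) (trans r+15≡a (identity w))
    where
    identity : ∀ w → 2 * suc w + 17 ≡ 2 * w + 4 + 15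
    identity = solve-∀

  numPrimitive≡3+r : numPrimitive ≡ 3 + r
  numPrimitive≡3+r = begin
    numPrimitive
      ≡⟨ primRange-split isPrimitive ⟩
    countFrom isPrimitive 0 κ + r + countFrom isPrimitive (κ + a) ℓ
      ≡⟨ cong₂ (λ below above → below + r + above) countFrom-primitive-below-κ (countFrom-primitive-above-κ+a ℓ) ⟩
    3 + r + 0
      ≡⟨ +-identityʳ (3 + r) ⟩
    3 + r ∎
    where open ≡-Reasoning

  numPrimitiveAbove≡r : numPrimitiveAbove ≡ r
  numPrimitiveAbove≡r = begin
    numPrimitiveAbove
      ≡⟨ primRange-split primitiveAbove ⟩
    countFrom primitiveAbove 0 κ + countFrom primitiveAbove κ a + countFrom primitiveAbove (κ + a) ℓ
      ≡⟨ cong₂ (λ below above → below + countFrom primitiveAbove κ a + above)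
               (countFrom-none primitiveAbove 0 κ (λ i _ i<κ → below-conductor i<κ))
               (countFrom-none primitiveAbove (κ + a) ℓ (λ i κ+a≤i _ → above-κ+a κ+a≤i)) ⟩
    countFrom primitiveAbove κ a + 0
      ≡⟨ +-identityʳ (countFrom primitiveAbove κ a) ⟩
    countFrom primitiveAbove κ a
      ≡⟨ countFrom-cong primitiveAbove isPrimitive κ a (λ i κ≤i _ → window κ≤i) ⟩
    r ∎
    where
    open ≡-Reasoning
    primitiveAbove : ℕ → Bool
    primitiveAbove n = isPrimitive n ∧ (conductor ≤ᵇ n)
    below-conductor : ∀ {i} → i < κ → ¬ T (primitiveAbove i)
    below-conductor {i} i<κ prim∧ = <⇒≱ i<κ (subst (_≤ i) conductor≡κ
      (≤ᵇ⇒≤ conductor i (proj₂ (to (T-∧ {isPrimitive i}) prim∧))))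
    above-κ+a : ∀ {i} → κ + a ≤ i → ¬ T (primitiveAbove i)
    above-κ+a {i} κ+a≤i prim∧ = subst T (primitive-above-κ+a κ+a≤i) (proj₁ (to (T-∧ {isPrimitive i}) prim∧))
    window : ∀ {i} → κ ≤ i → primitiveAbove i ≡ isPrimitive i
    window {i} κ≤i = trans (cong (isPrimitive i ∧_) (T⇒≡true (≤⇒≤ᵇ (subst (_≤ i) (sym conductor≡κ) κ≤i))))
                           (∧-identityʳ (isPrimitive i))

  multiplicity≡15+r : multiplicity ≡ 15 + r
  multiplicity≡15+r = trans multiplicity≡a (trans (sym r+15≡a) (+-comm r 15))

  eliahou≡-1 : eliahou ≡ -[1+ 0 ]
  eliahou≡-1 =
    trans (eliahou-≡ rank≡23 numPrimitive≡3+r numPrimitiveAbove≡r q≡5 multiplicity≡15+r ρ≡5)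
    (cong₂ (λ p−r m−r → + 23 *ℤ p−r -ℤ + 5 *ℤ m−r +ℤ + 5) (+[m+n]-+n≡+m 3 r) (+[m+n]-+n≡+m 15 r))

  wilf : conductor ≤ rank * numPrimitive
  wilf = subst₂ _≤_ (sym conductor≡κ)
    (sym (cong₂ _*_ rank≡23 (trans numPrimitive≡3+r (cong (_+_ 3) r≡2w+4))))
    (subst (κ ≤_) (sym (identity w)) (m≤m+n κ (71 + 36 * w)))
    where
    identity : ∀ w → 23 * (3 + (2 * w + 4)) ≡ 10 * (8 + suc w) + (71 + 36 * w)
    identity = solve-∀

-- Stated for a variable t: comparing invariants that are not syntactically equal unfolds them,
-- which is prohibitively slow once t is a numeral or of the form 8 + u.
module BEFCong (t : ℕ) {g : ℕ → Bool} (BEFmem≗g : ∀ n → BEFmem t n ≡ g n) where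
  private
    module C = InvariantsCong BEFmem≗g (10 * t)
    module G = Invariants g (10 * t)

  conductor-cong : BEF.conductor t ≡ G.conductor
  conductor-cong = C.conductor-cong

  multiplicity-cong : BEF.multiplicity t ≡ G.multiplicity
  multiplicity-cong = C.multiplicity-cong

  rank-cong : BEF.rank t ≡ G.rank
  rank-cong = C.rank-cong

  genus-cong : BEF.genus t ≡ G.genus
  genus-cong = C.genus-cong

  numPrimitive-cong : BEF.numPrimitive t ≡ G.numPrimitive
  numPrimitive-cong = C.numPrimitive-cong

  eliahou-cong : BEF.eliahou t ≡ G.eliahou
  eliahou-cong = C.eliahou-cong

BEF-eliahou₈ : BEF.eliahou 8 ≡ + 4
BEF-eliahou₈ = trans (BEFCong.eliahou-cong 8 (BEFmem≡explicit 0)) refl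

BEF-shape : ∀ u →
  (BEF.conductor (8 + u) ≡ 10 * (8 + u)) × (BEF.multiplicity (8 + u) ≡ 2 * (8 + u) + 1) ×
  (BEF.rank (8 + u) ≡ 23) × (BEF.genus (8 + u) ≡ 10 * (8 + u) ∸ 23)
BEF-shape u =
  trans conductor-cong conductor≡κ ,
  trans multiplicity-cong (trans multiplicity≡a (a-form u)) ,
  trans rank-cong rank≡23 ,
  trans genus-cong genus≡κ∸23
  where
  open ExplicitBEF u
  open BEFCong (8 + u) (BEFmem≡explicit u)

BEF-eliahou-wilf : ∀ w → (BEF.eliahou (9 + w) ≡ -[1+ 0 ]) ×
                         (BEF.conductor (9 + w) ≤ BEF.rank (9 + w) * BEF.numPrimitive (9 + w))
BEF-eliahou-wilf w =
  trans eliahou-cong eliahou≡-1 ,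
  subst₂ _≤_ (sym conductor-cong) (sym (cong₂ _*_ rank-cong numPrimitive-cong)) wilf
  where
  open ExplicitBEF⁺ w
  open BEFCong (8 + suc w) (BEFmem≡explicit (suc w))

mainTheorem8 :
  ((t : ℕ) → 8 ≤ t →
    (BEF.conductor t ≡ 10 * t)
    × (BEF.multiplicity t ≡ 2 * t + 1)
    × (BEF.rank t ≡ 23)
    × (BEF.genus t ≡ 10 * t ∸ 23))
  × (BEF.eliahou 8 ≡ + 4)
  × ((t : ℕ) → 9 ≤ t →
    (BEF.eliahou t ≡ -[1+ 0 ])
    × (BEF.conductor t ≤ BEF.rank t * BEF.numPrimitive t))
mainTheorem8 = ≥-elim 8 BEF-shape , BEF-eliahou₈ , ≥-elim 9 BEF-eliahou-wilf
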